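{- For every formula $\alpha$, $\vdash_{\mathsf{qG}} ko(\neg\neg\alpha)\Rightarrow ko(\alpha)$.
   Context: Formulas are built from propositional variables by $\alpha\cdot\beta$, $\alpha\backslash\beta$, $\alpha\wedge\beta$, $\alpha\vee\beta$, $\neg\alpha$; sequents are $\alpha\Rightarrow\beta$ with single formulas. The calculus $\mathsf{qG}$ has axiom $(\mathrm{Id})\ \alpha\Rightarrow\alpha$ and the rules (premises / conclusion): $(\mathrm{RES}\backslash)$ $\alpha\cdot\beta\Rightarrow\gamma$ / $\beta\Rightarrow\alpha\backslash\gamma$; $(\mathrm{RES}^-\backslash)$ $\beta\Rightarrow\alpha\backslash\gamma$ / $\alpha\cdot\beta\Rightarrow\gamma$; $(\wedge\mathrm{L})$ $\alpha\Rightarrow\beta$ / $\alpha\wedge\gamma\Rightarrow\beta$ and $\alpha\Rightarrow\beta$ / $\gamma\wedge\alpha\Rightarrow\beta$; $(\wedge\mathrm{R})$ $\alpha\Rightarrow\beta$, $\alpha\Rightarrow\gamma$ / $\alpha\Rightarrow\beta\wedge\gamma$; $(\vee\mathrm{L})$ $\alpha\Rightarrow\beta$, $\gamma\Rightarrow\beta$ / $\alpha\vee\gamma\Rightarrow\beta$; $(\vee\mathrm{R})$ $\alpha\Rightarrow\beta$ / $\alpha\Rightarrow\beta\vee\gamma$ and $\alpha\Rightarrow\beta$ / $\alpha\Rightarrow\gamma\vee\beta$; $(\neg)$ $\alpha\cdot\beta\Rightarrow\neg\gamma$ / $\gamma\cdot\beta\Rightarrow\neg\alpha$, together with its special case $(\mathrm{MN})$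 $\alpha\Rightarrow\neg\gamma$ / $\gamma\Rightarrow\neg\alpha$; $(\mathrm{Cut})$ $\alpha\Rightarrow\beta$, $\beta\Rightarrow\gamma$ / $\alpha\Rightarrow\gamma$. The Kolmogorov translation $ko$ is defined inductively: $ko(p)=\neg\neg p$ for variables $p$; $ko(\alpha\wedge\beta)=\neg\neg(ko(\alpha)\wedge ko(\beta))$; $ko(\alpha\vee\beta)=\neg\neg(ko(\alpha)\vee ko(\beta))$; $ko(\neg\alpha)=\neg ko(\alpha)$; $ko(\alpha\cdot\beta)=\neg\neg(ko(\alpha)\cdot ko(\beta))$; $ko(\alpha\backslash\beta)=\neg\neg(ko(\alpha)\backslash ko(\beta))$. -}

module Defs where

open import Data.Nat using (ℕ)

infixr 30 _·_
infixr 25 _＼_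
infixr 20 _∧_
infixr 15 _∨_
data Formula : Set where
  var  : ℕ → Formula
  _·_  : Formula → Formula → Formula
  _＼_ : Formula → Formula → Formula
  _∧_  : Formula → Formula → Formula
  _∨_  : Formula → Formula → Formula
  ¬ᶠ_  : Formula → Formula

infix 5 _⇒_
data _⇒_ : Formula → Formula → Set where
  Id    : ∀ {α} → α ⇒ α
  RES＼  : ∀ {α β γ} → (α · β) ⇒ γ → β ⇒ (α ＼ γ)
  RES⁻＼ : ∀ {α β γ} → β ⇒ (α ＼ γ) → (α · β) ⇒ γ
  ∧L₁   : ∀ {α β γ} → α ⇒ β → (α ∧ γ) ⇒ β
  ∧L₂   : ∀ {α β γ} → α ⇒ β → (γ ∧ α) ⇒ β
  ∧R    : ∀ {α β γ} → α ⇒ β → α ⇒ γ → α ⇒ (β ∧ γ)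
  ∨L    : ∀ {α β γ} → α ⇒ β → γ ⇒ β → (α ∨ γ) ⇒ β
  ∨R₁   : ∀ {α β γ} → α ⇒ β → α ⇒ (β ∨ γ)
  ∨R₂   : ∀ {α β γ} → α ⇒ β → α ⇒ (γ ∨ β)
  Neg   : ∀ {α β γ} → (α · β) ⇒ ¬ᶠ γ → (γ · β) ⇒ ¬ᶠ α
  MN    : ∀ {α γ} → α ⇒ ¬ᶠ γ → γ ⇒ ¬ᶠ α
  Cut   : ∀ {α β γ} → α ⇒ β → β ⇒ γ → α ⇒ γ

ko : Formula → Formula
ko (var p)  = ¬ᶠ ¬ᶠ var p
ko (α ∧ β)  = ¬ᶠ ¬ᶠ (ko α ∧ ko β)
ko (α ∨ β)  = ¬ᶠ ¬ᶠ (ko α ∨ ko β)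
ko (¬ᶠ α)   = ¬ᶠ ko α
ko (α · β)  = ¬ᶠ ¬ᶠ (ko α · ko β)
ko (α ＼ β) = ¬ᶠ ¬ᶠ (ko α ＼ ko β)

{-# OPTIONS --safe #-}
module Submission where

open import Defs

¬¬-intro : ∀ {γ} → γ ⇒ ¬ᶠ ¬ᶠ γ
¬¬-intro = MN Id

contraposition : ∀ {γ δ} → γ ⇒ δ → ¬ᶠ δ ⇒ ¬ᶠ γ
contraposition γ⇒δ = MN (Cut γ⇒δ ¬¬-intro)

¬¬¬-elim : ∀ {γ} → ¬ᶠ ¬ᶠ ¬ᶠ γ ⇒ ¬ᶠ γ
¬¬¬-elim = contraposition ¬¬-intro

-- Every clause of ko produces a negation, so ko (¬¬α) = ¬¬¬γ and ko α = ¬γ.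
lemma1 : (α : Formula) → ko (¬ᶠ ¬ᶠ α) ⇒ ko α
lemma1 (var p)  = ¬¬¬-elim
lemma1 (α · β)  = ¬¬¬-elim
lemma1 (α ＼ β) = ¬¬¬-elim
lemma1 (α ∧ β)  = ¬¬¬-elim
lemma1 (α ∨ β)  = ¬¬¬-elim
lemma1 (¬ᶠ α)   = ¬¬¬-elim
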